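{- Let $G$ be a $(C_3,C_5,C_6)$-free graph, let $x\in V(G)$, and let $Y\subseteq N(x)$ with $|Y|\geq 2$. For every $R\subseteq V(G)$, the following are equivalent: (a) $R\in\mathsf{MinRed}(G)$, $\mathsf{red}(R)=\{x\}$ and $N(x)\cap R=Y$; (b) $R=S\cup Y\cup\{x\}$ for a set $S$ such that (i) $S\subseteq N^2(x)$; (ii) $S\cap N(Y)=\emptyset$; (iii) every $y\in Y$ satisfies $\mathsf{priv}(y,Y\cup\{x\})\neq\emptyset$; and (iv) $S$ minimally dominates $N(x)\setminus Y$, i.e., $N(x)\setminus Y\subseteq N(S)$ and no proper subset $S'\subsetneq S$ satisfies $N(x)\setminus Y\subseteq N(S')$.
   Context: Graphs are finite, simple, undirected; $N(v),N[v]$ are open/closed neighborhoods, $N(A)=\bigcup_{a\in A}N(a)$, and $N^2(x)$ is the set of vertices at distance exactly $2$ from $x$. For $I\subseteq V(G)$ and $v\in I$, $\mathsf{priv}(v,I)=\{z\in N[v]:N[z]\cap I=\{v\}\}$. $I$ is irredundant if every element has nonempty $\mathsf{priv}$, redundant otherwise. $\mathsf{MinRed}(G)$ is the family of inclusion-wise minimal redundant sets; for redundant $R$, $\mathsf{red}(R)=\{v\in R:\mathsf{priv}(v,R)=\emptyset\}$. $(C_3,C_5,C_6)$-free means no induced cycle of length 3, 5 or 6. -}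

module Defs where

open import Data.Nat using (ℕ; suc; _%_; NonZero)
open import Data.Fin using (Fin; toℕ)
open import Data.Fin.Subset using (Subset; _∈_; _∉_; _⊂_)
open import Data.Bool using (Bool; T)
open import Data.Product using (Σ; ∃; _×_; _,_)
open import Data.Sum using (_⊎_)
open import Data.Empty using (⊥)
open import Relation.Nullary using (¬_)
open import Relation.Binary.PropositionalEquality using (_≡_; _≢_)
open import Function.Bundles using (_⇔_)
open import Function.Definitions using (Injective)

record Graph (n : ℕ) : Set where
  field
    adj     : Fin n → Fin n → Bool
    sym     : ∀ u v → adj u v ≡ adj v u
    irrefl  : ∀ v → adj v v ≡ Bool.false

open Graph public

module _ {n : ℕ} (G : Graph n) where

  Adj : Fin n → Fin n → Set
  Adj u v = T (adj G u v)

  InClosedNbhd : Fin n → Fin n → Set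
  InClosedNbhd v z = z ≡ v ⊎ Adj v z

  InNbhdSet : Subset n → Fin n → Set
  InNbhdSet A z = ∃ λ a → a ∈ A × Adj a z

  InN2 : Fin n → Fin n → Set
  InN2 x z = z ≢ x × ¬ Adj x z × (∃ λ w → Adj x w × Adj w z)

  -- z ∈ priv(v, I):  z ∈ N[v] and N[z] ∩ I = {v}
  InPriv : Fin n → Subset n → Fin n → Set
  InPriv v I z = InClosedNbhd v z × (∀ w → (InClosedNbhd z w × w ∈ I) ⇔ (w ≡ v))

  PrivNonempty : Fin n → Subset n → Set
  PrivNonempty v I = ∃ λ z → InPriv v I z

  PrivEmpty : Fin n → Subset n → Set
  PrivEmpty v I = ∀ z → ¬ InPriv v I z

  Irredundant : Subset n → Set
  Irredundant I = ∀ v → v ∈ I → PrivNonempty v I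

  Redundant : Subset n → Set
  Redundant I = ¬ Irredundant I

  MinRed : Subset n → Set
  MinRed R = Redundant R × (∀ R′ → R′ ⊂ R → ¬ Redundant R′)

  RedIsSingleton : Subset n → Fin n → Set
  RedIsSingleton R x = ∀ v → (v ∈ R × PrivEmpty v R) ⇔ (v ≡ x)

  NbhdMeet≡ : Fin n → Subset n → Subset n → Set
  NbhdMeet≡ x R Y = ∀ v → (Adj x v × v ∈ R) ⇔ (v ∈ Y)

  DominatesNxMinusY : Fin n → Subset n → Subset n → Set
  DominatesNxMinusY x Y S = ∀ v → Adj x v → v ∉ Y → InNbhdSet S v

  MinDominatesNxMinusY : Fin n → Subset n → Subset n → Set
  MinDominatesNxMinusY x Y S =
    DominatesNxMinusY x Y S × (∀ S′ → S′ ⊂ S → ¬ DominatesNxMinusY x Y S′)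

  CycConsec : (k : ℕ) .{{_ : NonZero k}} → Fin k → Fin k → Set
  CycConsec k i j = toℕ j ≡ suc (toℕ i) % k ⊎ toℕ i ≡ suc (toℕ j) % k

  HasInducedCycle : (k : ℕ) .{{_ : NonZero k}} → Set
  HasInducedCycle k =
    Σ (Fin k → Fin n) λ f → Injective _≡_ _≡_ f × (∀ i j → Adj (f i) (f j) ⇔ CycConsec k i j)

  C3C5C6Free : Set
  C3C5C6Free = ¬ HasInducedCycle 3 × ¬ HasInducedCycle 5 × ¬ HasInducedCycle 6

-- Put S = R ∖ (Y ∪ {x}). If R is minimal redundant with red(R) = {x}, then deleting any
-- u ≠ x from R makes x irredundant, and its new private neighbour z lies in N(x) ∩ N[u] with
-- N[z] ∩ R ⊆ {x, u}. With triangle-freeness these neighbours place S in N²(x) away from N(Y)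
-- and make S a minimal dominating set of N(x) ∖ Y. Conversely, minimality of the domination
-- gives every s ∈ S a private neighbour in N(x) ∖ Y; excluding induced 5-cycles, S is then
-- independent and the private neighbours of the y ∈ Y stay private in R, so x is the only
-- redundant vertex of R, and deleting any vertex gives x a private neighbour again.
module Submission where

open import Defs hiding (sym)
open import Data.Bool using (T; if_then_else_)
open import Data.Empty using (⊥; ⊥-elim)
open import Data.Fin using (Fin; toℕ; _≟_)
open import Data.Fin.Patterns using (0F; 1F; 2F; 3F; 4F)
open import Data.Fin.Properties using (all?; any?; ¬∀⟶∃¬)
open import Data.Fin.Subset
  using (Subset; _∈_; _∉_; _∪_; _─_; _-_; ⁅_⁆; ∣_∣; _⊆_; _⊂_; Nonempty)
open import Data.Fin.Subset.Properties
  using ( _∈?_; x∈p∪q⁺; x∈p∪q⁻; x∈⁅x⁆; x∈⁅y⁆⇒x≡y; ⊆-antisym; p⊆q⇒∣p∣≤∣q∣; ∣⁅x⁆∣≡1; ∪-assoc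
        ; p─q⊆p; x∈p∧x∉q⇒x∈p─q; x∈p∧x≢y⇒x∈p-y; x∈p⇒p-x⊂p )
open import Data.Nat using (ℕ; suc; _≤_; s≤s; NonZero; _%_)
open import Data.Nat.Properties using (≤-trans) renaming (_≟_ to _≟ℕ_)
open import Data.Product using (∃; _×_; _,_; proj₁; proj₂; map₂)
open import Data.Sum using (_⊎_; inj₁; inj₂; [_,_])
open import Data.Vec using ([]; _∷_; lookup; there)
open import Function using (_∘_)
open import Function.Bundles using (_⇔_; mk⇔; Equivalence)
open import Function.Definitions using (Injective)
open import Relation.Nullary using (¬_; Dec; yes; no; does)
open import Relation.Nullary.Decidable
  using (_×-dec_; _⊎-dec_; _→-dec_; ¬?; map′; from-yes; T?; decidable-stable)
open import Relation.Binary.PropositionalEquality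
  using (_≡_; _≢_; refl; sym; subst; module ≡-Reasoning)

dec-⇔ : ∀ {A C : Set} (C? : Dec C) → (if does C? then A else ¬ A) → A ⇔ C
dec-⇔ (yes c) a = mk⇔ (λ _ → c) (λ _ → a)
dec-⇔ (no ¬c) ¬a = mk⇔ (⊥-elim ∘ ¬a) (⊥-elim ∘ ¬c)

x∈p─q⇒x∉q : ∀ {n} {x : Fin n} (p q : Subset n) → x ∈ p ─ q → x ∉ q
x∈p─q⇒x∉q (_ ∷ p) (_ ∷ q) (there x∈p─q) (there x∈q) = x∈p─q⇒x∉q p q x∈p─q x∈q

x∈p-y⇒x≢y : ∀ {n} {x y : Fin n} (p : Subset n) → x ∈ p - y → x ≢ y
x∈p-y⇒x≢y p x∈p-y refl = x∈p─q⇒x∉q p ⁅ _ ⁆ x∈p-y (x∈⁅x⁆ _)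

p─q∪q≡p : ∀ {n} (p q : Subset n) → q ⊆ p → (p ─ q) ∪ q ≡ p
p─q∪q≡p p q q⊆p = ⊆-antisym (λ x∈ → [ p─q⊆p p q , q⊆p ] (x∈p∪q⁻ (p ─ q) q x∈)) p⊆
  where
  p⊆ : p ⊆ (p ─ q) ∪ q
  p⊆ {x} x∈p with x ∈? q
  ... | yes x∈q = x∈p∪q⁺ (inj₂ x∈q)
  ... | no x∉q = x∈p∪q⁺ (inj₁ (x∈p∧x∉q⇒x∈p─q x∈p x∉q))

2≤∣p∣⇒∃∈p≢ : ∀ {n} (p : Subset n) → 2 ≤ ∣ p ∣ → ∀ y → ∃ λ x → x ∈ p × x ≢ y
2≤∣p∣⇒∃∈p≢ p 2≤∣p∣ y with any? (λ x → (x ∈? p) ×-dec ¬? (x ≟ y))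
... | yes found = found
... | no none = ⊥-elim (2≰1 (≤-trans 2≤∣p∣ (subst (∣ p ∣ ≤_) (∣⁅x⁆∣≡1 y) (p⊆q⇒∣p∣≤∣q∣ p⊆⁅y⁆))))
  where
  p⊆⁅y⁆ : p ⊆ ⁅ y ⁆
  p⊆⁅y⁆ {x} x∈p with x ≟ y
  ... | yes refl = x∈⁅x⁆ y
  ... | no x≢y = ⊥-elim (none (x , x∈p , x≢y))
  2≰1 : ¬ (2 ≤ 1)
  2≰1 (s≤s ())

module _ {n : ℕ} (G : Graph n) where

  Adj-sym : ∀ {u v} → Adj G u v → Adj G v u
  Adj-sym {u} {v} = subst T (Graph.sym G u v)

  Adj-irrefl : ∀ {v} → ¬ Adj G v v
  Adj-irrefl {v} = subst T (Graph.irrefl G v)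

  Adj⇒≢ : ∀ {u v} → Adj G u v → u ≢ v
  Adj⇒≢ u~v refl = Adj-irrefl u~v

  adj? : ∀ u v → Dec (Adj G u v)
  adj? u v = T? (adj G u v)

  InClosedNbhd-sym : ∀ {v z} → InClosedNbhd G v z → InClosedNbhd G z v
  InClosedNbhd-sym (inj₁ refl) = inj₁ refl
  InClosedNbhd-sym (inj₂ v~z) = inj₂ (Adj-sym v~z)

  inClosedNbhd? : ∀ v z → Dec (InClosedNbhd G v z)
  inClosedNbhd? v z = (z ≟ v) ⊎-dec adj? v z

  inNbhdSet? : ∀ A z → Dec (InNbhdSet G A z)
  inNbhdSet? A z = any? λ a → (a ∈? A) ×-dec adj? a z

  undominated : ∀ {x Y S} → ¬ DominatesNxMinusY G x Y S →
    ∃ λ v → Adj G x v × v ∉ Y × ¬ InNbhdSet G S v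
  undominated {x} {Y} {S} ¬dom
    with ¬∀⟶∃¬ n _ (λ v → adj? x v →-dec (¬? (v ∈? Y) →-dec inNbhdSet? S v)) ¬dom
  ... | v , ¬dom-v with adj? x v | v ∈? Y | inNbhdSet? S v
  ... | yes x~v | no v∉Y | no v∉N⟨S⟩ = v , x~v , v∉Y , v∉N⟨S⟩
  ... | no x≁v | _ | _ = ⊥-elim (¬dom-v (⊥-elim ∘ x≁v))
  ... | yes _ | yes v∈Y | _ = ⊥-elim (¬dom-v (λ _ v∉Y → ⊥-elim (v∉Y v∈Y)))
  ... | yes _ | no _ | yes v∈N⟨S⟩ = ⊥-elim (¬dom-v (λ _ _ → v∈N⟨S⟩))

  inPriv : ∀ {v I z} → InClosedNbhd G v z → v ∈ I →
    (∀ w → InClosedNbhd G z w → w ∈ I → w ≡ v) → InPriv G v I z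
  inPriv v≈z v∈I unique =
    v≈z , λ w → mk⇔ (λ (z≈w , w∈I) → unique w z≈w w∈I) (λ { refl → InClosedNbhd-sym v≈z , v∈I })

  inPriv-member : ∀ {v I z} → InPriv G v I z → v ∈ I
  inPriv-member {v} (_ , private-at) = proj₂ (Equivalence.from (private-at v) refl)

  inPriv-unique : ∀ {v I z} → InPriv G v I z → ∀ w → InClosedNbhd G z w → w ∈ I → w ≡ v
  inPriv-unique (_ , private-at) w z≈w w∈I = Equivalence.to (private-at w) (z≈w , w∈I)

  inPriv? : ∀ v I z → Dec (InPriv G v I z)
  inPriv? v I z =
    map′ (λ (v≈z , v∈I , unique) → inPriv v≈z v∈I unique)
         (λ p → proj₁ p , inPriv-member p , inPriv-unique p)
         (inClosedNbhd? v z ×-dec (v ∈? I) ×-dec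
           all? λ w → inClosedNbhd? z w →-dec (w ∈? I) →-dec (w ≟ v))

  privNonempty? : ∀ v I → Dec (PrivNonempty G v I)
  privNonempty? v I = any? (inPriv? v I)

  inPriv-⊆ : ∀ {v I J z} → J ⊆ I → v ∈ J → InPriv G v I z → InPriv G v J z
  inPriv-⊆ J⊆I v∈J p = inPriv (proj₁ p) v∈J (λ w z≈w w∈J → inPriv-unique p w z≈w (J⊆I w∈J))

  irredundant-⊆ : ∀ {I J} → J ⊆ I → Irredundant G I → Irredundant G J
  irredundant-⊆ J⊆I irr v v∈J = map₂ (inPriv-⊆ J⊆I v∈J) (irr v (J⊆I v∈J))

  irredundant? : ∀ I → Dec (Irredundant G I)
  irredundant? I = all? λ v → (v ∈? I) →-dec privNonempty? v I

  minRed⇒irredundant-deletion : ∀ {I u} → MinRed G I → u ∈ I → Irredundant G (I - u)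
  minRed⇒irredundant-deletion {I} {u} (_ , minimal) u∈I =
    decidable-stable (irredundant? (I - u)) (minimal (I - u) (x∈p⇒p-x⊂p u∈I))

  irredundant-deletions⇒minRed : ∀ {I} → Redundant G I →
    (∀ u → u ∈ I → Irredundant G (I - u)) → MinRed G I
  irredundant-deletions⇒minRed {I} red deletion-irr = red , minimal
    where
    minimal : ∀ J → J ⊂ I → ¬ Redundant G J
    minimal J (J⊆I , u , u∈I , u∉J) red-J = red-J (irredundant-⊆ J⊆I-u (deletion-irr u u∈I))
      where
      J⊆I-u : J ⊆ I - u
      J⊆I-u v∈J = x∈p∧x≢y⇒x∈p-y (J⊆I v∈J) (λ { refl → u∉J v∈J })

  redIsSingleton⇒privNonempty : ∀ {I x v} → RedIsSingleton G I x → v ∈ I → v ≢ x →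
    PrivNonempty G v I
  redIsSingleton⇒privNonempty {I} {x} {v} red≡x v∈I v≢x with privNonempty? v I
  ... | yes nonempty = nonempty
  ... | no empty = ⊥-elim (v≢x (Equivalence.to (red≡x v) (v∈I , λ z p → empty (z , p))))

  redIsSingleton : ∀ {I x} → x ∈ I → PrivEmpty G x I →
    (∀ v → v ∈ I → v ≢ x → PrivNonempty G v I) → RedIsSingleton G I x
  redIsSingleton {I} {x} x∈I x-red others v = mk⇔ only-x (λ { refl → x∈I , x-red })
    where
    only-x : v ∈ I × PrivEmpty G v I → v ≡ x
    only-x (v∈I , v-red) with v ≟ x
    ... | yes v≡x = v≡x
    ... | no v≢x = ⊥-elim (v-red _ (proj₂ (others v v∈I v≢x)))

  cycConsec? : (k : ℕ) .{{_ : NonZero k}} → ∀ i j → Dec (CycConsec G k i j)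
  cycConsec? k i j = (toℕ j ≟ℕ suc (toℕ i) % k) ⊎-dec (toℕ i ≟ℕ suc (toℕ j) % k)

  ConsecutivenessSeparates : (k : ℕ) .{{_ : NonZero k}} → Set
  ConsecutivenessSeparates k = ∀ i j → i ≡ j ⊎ ∃ λ m → CycConsec G k i m × ¬ CycConsec G k j m

  consecutivenessSeparates? : (k : ℕ) .{{_ : NonZero k}} → Dec (ConsecutivenessSeparates k)
  consecutivenessSeparates? k =
    all? λ i → all? λ j → (i ≟ j) ⊎-dec any? λ m → cycConsec? k i m ×-dec ¬? (cycConsec? k j m)

  EdgePattern : (k : ℕ) .{{_ : NonZero k}} → (Fin k → Fin n) → Set
  EdgePattern k f =
    ∀ i j → if does (cycConsec? k i j) then Adj G (f i) (f j) else ¬ Adj G (f i) (f j)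

  inducedCycle : (k : ℕ) .{{_ : NonZero k}} → ConsecutivenessSeparates k →
    (f : Fin k → Fin n) → EdgePattern k f → HasInducedCycle G k
  inducedCycle k separates f edges = f , injective , adj⇔consec
    where
    adj⇔consec : ∀ i j → Adj G (f i) (f j) ⇔ CycConsec G k i j
    adj⇔consec i j = dec-⇔ (cycConsec? k i j) (edges i j)
    -- f i ≡ f j would make j consecutive to every cycle-neighbour of i.
    injective : Injective _≡_ _≡_ f
    injective {i} {j} fi≡fj with separates i j
    ... | inj₁ i≡j = i≡j
    ... | inj₂ (m , i~m , j≁m) =
      ⊥-elim (j≁m (Equivalence.to (adj⇔consec j m)
        (subst (λ v → Adj G v (f m)) fi≡fj (Equivalence.from (adj⇔consec i m) i~m))))

  triangle-free : ¬ HasInducedCycle G 3 → ∀ {a b c} → Adj G a b → Adj G b c → Adj G a c → ⊥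
  triangle-free noC3 {a} {b} {c} ab bc ac =
    noC3 (inducedCycle 3 (from-yes (consecutivenessSeparates? 3)) (lookup (a ∷ b ∷ c ∷ [])) edges)
    where
    edges : EdgePattern 3 (lookup (a ∷ b ∷ c ∷ []))
    edges 0F 0F = Adj-irrefl
    edges 0F 1F = ab
    edges 0F 2F = ac
    edges 1F 0F = Adj-sym ab
    edges 1F 1F = Adj-irrefl
    edges 1F 2F = bc
    edges 2F 0F = Adj-sym ac
    edges 2F 1F = Adj-sym bc
    edges 2F 2F = Adj-irrefl

  no-induced-C5 : ¬ HasInducedCycle G 5 → ∀ {a b c d e} →
    Adj G a b → Adj G b c → Adj G c d → Adj G d e → Adj G e a →
    ¬ Adj G a c → ¬ Adj G a d → ¬ Adj G b d → ¬ Adj G b e → ¬ Adj G c e → ⊥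
  no-induced-C5 noC5 {a} {b} {c} {d} {e} ab bc cd de ea ¬ac ¬ad ¬bd ¬be ¬ce =
    noC5 (inducedCycle 5 (from-yes (consecutivenessSeparates? 5))
                         (lookup (a ∷ b ∷ c ∷ d ∷ e ∷ [])) edges)
    where
    edges : EdgePattern 5 (lookup (a ∷ b ∷ c ∷ d ∷ e ∷ []))
    edges 0F 0F = Adj-irrefl
    edges 0F 1F = ab
    edges 0F 2F = ¬ac
    edges 0F 3F = ¬ad
    edges 0F 4F = Adj-sym ea
    edges 1F 0F = Adj-sym ab
    edges 1F 1F = Adj-irrefl
    edges 1F 2F = bc
    edges 1F 3F = ¬bd
    edges 1F 4F = ¬be
    edges 2F 0F = ¬ac ∘ Adj-sym
    edges 2F 1F = Adj-sym bc
    edges 2F 2F = Adj-irrefl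
    edges 2F 3F = cd
    edges 2F 4F = ¬ce
    edges 3F 0F = ¬ad ∘ Adj-sym
    edges 3F 1F = ¬bd ∘ Adj-sym
    edges 3F 2F = Adj-sym cd
    edges 3F 3F = Adj-irrefl
    edges 3F 4F = de
    edges 4F 0F = ea
    edges 4F 1F = ¬be ∘ Adj-sym
    edges 4F 2F = ¬ce ∘ Adj-sym
    edges 4F 3F = Adj-sym de
    edges 4F 4F = Adj-irrefl

module MinRed⇒Decomposition {n : ℕ} (G : Graph n) (noC3 : ¬ HasInducedCycle G 3)
  (x : Fin n) (Y : Subset n) (Y⊆N⟨x⟩ : ∀ y → y ∈ Y → Adj G x y) (2≤∣Y∣ : 2 ≤ ∣ Y ∣)
  (R : Subset n) (minRed : MinRed G R) (red≡x : RedIsSingleton G R x) (N⟨x⟩∩R≡Y : NbhdMeet≡ G x R Y)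
  where

  x∈R : x ∈ R
  x∈R = proj₁ (Equivalence.from (red≡x x) refl)

  x-redundant : PrivEmpty G x R
  x-redundant = proj₂ (Equivalence.from (red≡x x) refl)

  Y⊆R : Y ⊆ R
  Y⊆R y∈Y = proj₂ (Equivalence.from (N⟨x⟩∩R≡Y _) y∈Y)

  N⟨x⟩∩R⊆Y : ∀ {v} → Adj G x v → v ∈ R → v ∈ Y
  N⟨x⟩∩R⊆Y x~v v∈R = Equivalence.to (N⟨x⟩∩R≡Y _) (x~v , v∈R)

  Y≢x : ∀ {y} → y ∈ Y → y ≢ x
  Y≢x y∈Y = Adj⇒≢ G (Y⊆N⟨x⟩ _ y∈Y) ∘ sym

  Y∪x⊆R : Y ∪ ⁅ x ⁆ ⊆ R
  Y∪x⊆R v∈ = [ Y⊆R , (λ v∈⁅x⁆ → subst (_∈ R) (sym (x∈⁅y⁆⇒x≡y x v∈⁅x⁆)) x∈R) ] (x∈p∪q⁻ Y ⁅ x ⁆ v∈)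

  deletion-private-neighbour : ∀ {u} → u ∈ R → u ≢ x →
    ∃ λ z → Adj G x z × InClosedNbhd G u z × InPriv G x (R - u) z
  deletion-private-neighbour {u} u∈R u≢x
    with minRed⇒irredundant-deletion G minRed u∈R x (x∈p∧x≢y⇒x∈p-y x∈R (u≢x ∘ sym))
  -- z = x is impossible: a vertex of Y other than u stays in N[x] ∩ (R - u).
  ... | z , p@(inj₁ refl , _) with 2≤∣p∣⇒∃∈p≢ Y 2≤∣Y∣ u
  ... | y , y∈Y , y≢u =
    ⊥-elim (Y≢x y∈Y (inPriv-unique G p y (inj₂ (Y⊆N⟨x⟩ y y∈Y)) (x∈p∧x≢y⇒x∈p-y (Y⊆R y∈Y) y≢u)))
  deletion-private-neighbour {u} u∈R u≢x | z , p@(inj₂ x~z , _) with inClosedNbhd? G u z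
  ... | yes u≈z = z , x~z , u≈z , p
  ... | no u≉z = ⊥-elim (x-redundant z (inPriv G (inj₂ x~z) x∈R only-x))
    where
    -- u ∉ N[z], so z was already private for x in R.
    only-x : ∀ w → InClosedNbhd G z w → w ∈ R → w ≡ x
    only-x w z≈w w∈R =
      inPriv-unique G p w z≈w (x∈p∧x≢y⇒x∈p-y w∈R (λ { refl → u≉z (InClosedNbhd-sym G z≈w) }))

  S : Subset n
  S = R ─ (Y ∪ ⁅ x ⁆)

  S⊆R : S ⊆ R
  S⊆R = p─q⊆p R (Y ∪ ⁅ x ⁆)

  S∌Y : ∀ {s} → s ∈ S → s ∉ Y
  S∌Y s∈S s∈Y = x∈p─q⇒x∉q R (Y ∪ ⁅ x ⁆) s∈S (x∈p∪q⁺ (inj₁ s∈Y))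

  S≢x : ∀ {s} → s ∈ S → s ≢ x
  S≢x s∈S refl = x∈p─q⇒x∉q R (Y ∪ ⁅ x ⁆) s∈S (x∈p∪q⁺ (inj₂ (x∈⁅x⁆ x)))

  ∈S : ∀ {w} → w ∈ R → w ∉ Y → w ≢ x → w ∈ S
  ∈S w∈R w∉Y w≢x = x∈p∧x∉q⇒x∈p─q w∈R ([ w∉Y , w≢x ∘ x∈⁅y⁆⇒x≡y x ] ∘ x∈p∪q⁻ Y ⁅ x ⁆)

  R≡S∪Y∪x : R ≡ (S ∪ Y) ∪ ⁅ x ⁆
  R≡S∪Y∪x = begin
    R                  ≡⟨ sym (p─q∪q≡p R (Y ∪ ⁅ x ⁆) Y∪x⊆R) ⟩
    S ∪ (Y ∪ ⁅ x ⁆)    ≡⟨ sym (∪-assoc S Y ⁅ x ⁆) ⟩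
    (S ∪ Y) ∪ ⁅ x ⁆    ∎
    where open ≡-Reasoning

  S⊆N² : ∀ s → s ∈ S → InN2 G x s
  S⊆N² s s∈S with deletion-private-neighbour (S⊆R s∈S) (S≢x s∈S)
  ... | z , x~z , s≈z , _ =
    S≢x s∈S , x≁s , z , x~z , [ (λ { refl → ⊥-elim (x≁s x~z) }) , Adj-sym G ] s≈z
    where
    x≁s : ¬ Adj G x s
    x≁s x~s = S∌Y s∈S (N⟨x⟩∩R⊆Y x~s (S⊆R s∈S))

  S∩N⟨Y⟩≡∅ : ∀ s → s ∈ S → ¬ InNbhdSet G Y s
  S∩N⟨Y⟩≡∅ s s∈S (y , y∈Y , y~s) with deletion-private-neighbour (Y⊆R y∈Y) (Y≢x y∈Y)
  ... | _ , _ , inj₁ refl , p =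
    S≢x s∈S (inPriv-unique G p s (inj₂ y~s) (x∈p∧x≢y⇒x∈p-y (S⊆R s∈S) (λ { refl → S∌Y s∈S y∈Y })))
  ... | _ , x~z , inj₂ y~z , _ = triangle-free G noC3 (Y⊆N⟨x⟩ y y∈Y) y~z x~z

  Y-private : ∀ y → y ∈ Y → PrivNonempty G y (Y ∪ ⁅ x ⁆)
  Y-private y y∈Y =
    map₂ (inPriv-⊆ G Y∪x⊆R (x∈p∪q⁺ (inj₁ y∈Y)))
         (redIsSingleton⇒privNonempty G red≡x (Y⊆R y∈Y) (Y≢x y∈Y))

  S-dominates : DominatesNxMinusY G x Y S
  S-dominates v x~v v∉Y with inNbhdSet? G S v
  ... | yes v∈N⟨S⟩ = v∈N⟨S⟩
  ... | no v∉N⟨S⟩ = ⊥-elim (x-redundant v (inPriv G (inj₂ x~v) x∈R only-x))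
    where
    only-x : ∀ w → InClosedNbhd G v w → w ∈ R → w ≡ x
    only-x w (inj₁ refl) w∈R = ⊥-elim (v∉Y (N⟨x⟩∩R⊆Y x~v w∈R))
    only-x w (inj₂ v~w) w∈R with w ≟ x | w ∈? Y
    ... | yes w≡x | _ = w≡x
    ... | no _ | yes w∈Y = ⊥-elim (triangle-free G noC3 x~v v~w (Y⊆N⟨x⟩ w w∈Y))
    ... | no w≢x | no w∉Y = ⊥-elim (v∉N⟨S⟩ (w , ∈S w∈R w∉Y w≢x , Adj-sym G v~w))

  deletion-private-neighbour-∉Y : ∀ {u z} → u ∉ Y → Adj G x z → InPriv G x (R - u) z → z ∉ Y
  deletion-private-neighbour-∉Y u∉Y x~z p z∈Y =
    Adj⇒≢ G x~z (sym (inPriv-unique G p _ (inj₁ refl)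
                        (x∈p∧x≢y⇒x∈p-y (Y⊆R z∈Y) λ { refl → u∉Y z∈Y })))

  S-minimal : ∀ S′ → S′ ⊂ S → ¬ DominatesNxMinusY G x Y S′
  S-minimal S′ (S′⊆S , u , u∈S , u∉S′) dominates
    with deletion-private-neighbour (S⊆R u∈S) (S≢x u∈S)
  ... | z , x~z , _ , p with dominates z x~z (deletion-private-neighbour-∉Y (S∌Y u∈S) x~z p)
  ... | a , a∈S′ , a~z =
    S≢x (S′⊆S a∈S′)
      (inPriv-unique G p a (inj₂ (Adj-sym G a~z))
        (x∈p∧x≢y⇒x∈p-y (S⊆R (S′⊆S a∈S′)) λ { refl → u∉S′ a∈S′ }))

module Decomposition⇒MinRed {n : ℕ} (G : Graph n)
  (noC3 : ¬ HasInducedCycle G 3) (noC5 : ¬ HasInducedCycle G 5)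
  (x : Fin n) (Y : Subset n) (Y⊆N⟨x⟩ : ∀ y → y ∈ Y → Adj G x y) (Y≢∅ : Nonempty Y)
  (R S : Subset n) (R≡S∪Y∪x : R ≡ (S ∪ Y) ∪ ⁅ x ⁆)
  (S⊆N² : ∀ s → s ∈ S → InN2 G x s) (S∩N⟨Y⟩≡∅ : ∀ s → s ∈ S → ¬ InNbhdSet G Y s)
  (Y-private : ∀ y → y ∈ Y → PrivNonempty G y (Y ∪ ⁅ x ⁆)) (S-minDom : MinDominatesNxMinusY G x Y S)
  where

  data InR (v : Fin n) : Set where
    inS : v ∈ S → InR v
    inY : v ∈ Y → InR v
    isX : v ≡ x → InR v

  inR : ∀ {v} → v ∈ R → InR v
  inR {v} v∈R with x∈p∪q⁻ (S ∪ Y) ⁅ x ⁆ (subst (v ∈_) R≡S∪Y∪x v∈R)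
  ... | inj₂ v∈⁅x⁆ = isX (x∈⁅y⁆⇒x≡y x v∈⁅x⁆)
  ... | inj₁ v∈S∪Y = [ inS , inY ] (x∈p∪q⁻ S Y v∈S∪Y)

  ∈R : ∀ {v} → v ∈ (S ∪ Y) ∪ ⁅ x ⁆ → v ∈ R
  ∈R {v} = subst (v ∈_) (sym R≡S∪Y∪x)

  S⊆R : S ⊆ R
  S⊆R s∈S = ∈R (x∈p∪q⁺ (inj₁ (x∈p∪q⁺ (inj₁ s∈S))))

  Y⊆R : Y ⊆ R
  Y⊆R y∈Y = ∈R (x∈p∪q⁺ (inj₁ (x∈p∪q⁺ (inj₂ y∈Y))))

  x∈R : x ∈ R
  x∈R = ∈R (x∈p∪q⁺ (inj₂ (x∈⁅x⁆ x)))

  x∈R-u : ∀ {u} → u ≢ x → x ∈ R - u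
  x∈R-u u≢x = x∈p∧x≢y⇒x∈p-y x∈R (u≢x ∘ sym)

  S≢x : ∀ {s} → s ∈ S → s ≢ x
  S≢x s∈S = proj₁ (S⊆N² _ s∈S)

  x≁S : ∀ {s} → s ∈ S → ¬ Adj G x s
  x≁S s∈S = proj₁ (proj₂ (S⊆N² _ s∈S))

  S-private-neighbour : ∀ {s} → s ∈ S →
    ∃ λ v → Adj G x v × v ∉ Y × Adj G s v × (∀ t → t ∈ S → Adj G t v → t ≡ s)
  S-private-neighbour {s} s∈S with undominated G (proj₂ S-minDom (S - s) (x∈p⇒p-x⊂p s∈S))
  ... | v , x~v , v∉Y , v∉N⟨S-s⟩ = v , x~v , v∉Y , s~v , only-s
    where
    only-s : ∀ t → t ∈ S → Adj G t v → t ≡ s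
    only-s t t∈S t~v with t ≟ s
    ... | yes t≡s = t≡s
    ... | no t≢s = ⊥-elim (v∉N⟨S-s⟩ (t , x∈p∧x≢y⇒x∈p-y t∈S t≢s , t~v))
    s~v : Adj G s v
    s~v with proj₁ S-minDom v x~v v∉Y
    ... | t , t∈S , t~v = subst (λ t → Adj G t v) (only-s t t∈S t~v) t~v

  -- An edge s t inside S closes the induced 5-cycle x v s t v′ through the private neighbours.
  S-independent : ∀ {s t} → s ∈ S → t ∈ S → ¬ Adj G s t
  S-independent {s} {t} s∈S t∈S s~t with S-private-neighbour s∈S | S-private-neighbour t∈S
  ... | v , x~v , _ , s~v , only-s | v′ , x~v′ , _ , t~v′ , only-t =
    no-induced-C5 G noC5 x~v (Adj-sym G s~v) s~t t~v′ (Adj-sym G x~v′) (x≁S s∈S) (x≁S t∈S)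
      (λ v~t → Adj-irrefl G (subst (Adj G s) (only-s t t∈S (Adj-sym G v~t)) s~t))
      (λ v~v′ → triangle-free G noC3 x~v v~v′ x~v′)
      (λ s~v′ → Adj-irrefl G (subst (λ r → Adj G r t) (only-t s s∈S s~v′) s~t))

  S-self-private : ∀ {s} → s ∈ S → InPriv G s R s
  S-self-private {s} s∈S = inPriv G (inj₁ refl) (S⊆R s∈S) only-s
    where
    only-s : ∀ w → InClosedNbhd G s w → w ∈ R → w ≡ s
    only-s w (inj₁ w≡s) _ = w≡s
    only-s w (inj₂ s~w) w∈R with inR w∈R
    ... | inS w∈S = ⊥-elim (S-independent s∈S w∈S s~w)
    ... | inY w∈Y = ⊥-elim (S∩N⟨Y⟩≡∅ s s∈S (w , w∈Y , Adj-sym G s~w))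
    ... | isX refl = ⊥-elim (x≁S s∈S (Adj-sym G s~w))

  Y-private∩N[S]≡∅ : ∀ {y z w} → y ∈ Y → InPriv G y (Y ∪ ⁅ x ⁆) z → w ∈ S → ¬ InClosedNbhd G z w
  Y-private∩N[S]≡∅ {y} y∈Y (inj₁ refl , _) w∈S (inj₁ refl) = x≁S w∈S (Y⊆N⟨x⟩ y y∈Y)
  Y-private∩N[S]≡∅ {y} y∈Y (inj₁ refl , _) w∈S (inj₂ y~w) = S∩N⟨Y⟩≡∅ _ w∈S (y , y∈Y , y~w)
  Y-private∩N[S]≡∅ {y} y∈Y (inj₂ y~z , _) w∈S (inj₁ refl) = S∩N⟨Y⟩≡∅ _ w∈S (y , y∈Y , y~z)
  Y-private∩N[S]≡∅ {y} {z} {w} y∈Y p@(inj₂ y~z , _) w∈S (inj₂ z~w) with S⊆N² w w∈S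
  ... | _ , _ , u , x~u , u~w =
    no-induced-C5 G noC5 (Y⊆N⟨x⟩ y y∈Y) y~z z~w (Adj-sym G u~w) (Adj-sym G x~u)
      (λ x~z → Adj⇒≢ G (Y⊆N⟨x⟩ y y∈Y)
                 (inPriv-unique G p x (inj₂ (Adj-sym G x~z)) (x∈p∪q⁺ (inj₂ (x∈⁅x⁆ x)))))
      (x≁S w∈S)
      (λ y~w → S∩N⟨Y⟩≡∅ w w∈S (y , y∈Y , y~w))
      (λ y~u → triangle-free G noC3 (Y⊆N⟨x⟩ y y∈Y) y~u x~u)
      (λ z~u → triangle-free G noC3 z~w (Adj-sym G u~w) z~u)

  Y-private-in-R : ∀ {y} → y ∈ Y → PrivNonempty G y R
  Y-private-in-R {y} y∈Y with Y-private y y∈Y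
  ... | z , p = z , inPriv G (proj₁ p) (Y⊆R y∈Y) only-y
    where
    only-y : ∀ w → InClosedNbhd G z w → w ∈ R → w ≡ y
    only-y w z≈w w∈R with inR w∈R
    ... | inS w∈S = ⊥-elim (Y-private∩N[S]≡∅ y∈Y p w∈S z≈w)
    ... | inY w∈Y = inPriv-unique G p w z≈w (x∈p∪q⁺ (inj₁ w∈Y))
    ... | isX refl = inPriv-unique G p w z≈w (x∈p∪q⁺ (inj₂ (x∈⁅x⁆ x)))

  x-redundant : PrivEmpty G x R
  x-redundant _ p@(inj₁ refl , _) =
    let y , y∈Y = Y≢∅
    in Adj⇒≢ G (Y⊆N⟨x⟩ y y∈Y) (sym (inPriv-unique G p y (inj₂ (Y⊆N⟨x⟩ y y∈Y)) (Y⊆R y∈Y)))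
  x-redundant z p@(inj₂ x~z , _) with z ∈? Y
  ... | yes z∈Y = Adj⇒≢ G x~z (sym (inPriv-unique G p z (inj₁ refl) (Y⊆R z∈Y)))
  ... | no z∉Y with proj₁ S-minDom z x~z z∉Y
  ... | s , s∈S , s~z = S≢x s∈S (inPriv-unique G p s (inj₂ (Adj-sym G s~z)) (S⊆R s∈S))

  others-private : ∀ v → v ∈ R → v ≢ x → PrivNonempty G v R
  others-private v v∈R v≢x with inR v∈R
  ... | inS v∈S = v , S-self-private v∈S
  ... | inY v∈Y = Y-private-in-R v∈Y
  ... | isX v≡x = ⊥-elim (v≢x v≡x)

  x-private-after-deletion : ∀ {u} → u ∈ R → u ≢ x → PrivNonempty G x (R - u)
  x-private-after-deletion {u} u∈R u≢x with inR u∈R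
  ... | isX u≡x = ⊥-elim (u≢x u≡x)
  ... | inY u∈Y = u , inPriv G (inj₂ (Y⊆N⟨x⟩ u u∈Y)) (x∈R-u u≢x) only-x
    where
    only-x : ∀ w → InClosedNbhd G u w → w ∈ R - u → w ≡ x
    only-x w (inj₁ w≡u) w∈R-u = ⊥-elim (x∈p-y⇒x≢y R w∈R-u w≡u)
    only-x w (inj₂ u~w) w∈R-u with inR (p─q⊆p R ⁅ u ⁆ w∈R-u)
    ... | inS w∈S = ⊥-elim (S∩N⟨Y⟩≡∅ w w∈S (u , u∈Y , u~w))
    ... | inY w∈Y = ⊥-elim (triangle-free G noC3 (Y⊆N⟨x⟩ u u∈Y) u~w (Y⊆N⟨x⟩ w w∈Y))
    ... | isX w≡x = w≡x
  ... | inS u∈S with S-private-neighbour u∈S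
  ... | v , x~v , v∉Y , _ , only-u = v , inPriv G (inj₂ x~v) (x∈R-u u≢x) only-x
    where
    only-x : ∀ w → InClosedNbhd G v w → w ∈ R - u → w ≡ x
    only-x w (inj₁ refl) w∈R-u with inR (p─q⊆p R ⁅ u ⁆ w∈R-u)
    ... | inS w∈S = ⊥-elim (x≁S w∈S x~v)
    ... | inY w∈Y = ⊥-elim (v∉Y w∈Y)
    ... | isX w≡x = w≡x
    only-x w (inj₂ v~w) w∈R-u with inR (p─q⊆p R ⁅ u ⁆ w∈R-u)
    ... | inS w∈S = ⊥-elim (x∈p-y⇒x≢y R w∈R-u (only-u w w∈S (Adj-sym G v~w)))
    ... | inY w∈Y = ⊥-elim (triangle-free G noC3 x~v v~w (Y⊆N⟨x⟩ w w∈Y))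
    ... | isX w≡x = w≡x

  irredundant-deletion : ∀ u → u ∈ R → Irredundant G (R - u)
  irredundant-deletion u u∈R v v∈R-u with v ≟ x
  ... | yes refl = x-private-after-deletion u∈R (x∈p-y⇒x≢y R v∈R-u ∘ sym)
  ... | no v≢x =
    map₂ (inPriv-⊆ G (p─q⊆p R ⁅ u ⁆) v∈R-u) (others-private v (p─q⊆p R ⁅ u ⁆ v∈R-u) v≢x)

  R-minRed : MinRed G R
  R-minRed =
    irredundant-deletions⇒minRed G (λ irr → x-redundant _ (proj₂ (irr x x∈R))) irredundant-deletion

  R-red≡x : RedIsSingleton G R x
  R-red≡x = redIsSingleton G x∈R x-redundant others-private

  N⟨x⟩∩R≡Y : NbhdMeet≡ G x R Y
  N⟨x⟩∩R≡Y v = mk⇔ N⟨x⟩∩R⊆Y (λ v∈Y → Y⊆N⟨x⟩ v v∈Y , Y⊆R v∈Y)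
    where
    N⟨x⟩∩R⊆Y : Adj G x v × v ∈ R → v ∈ Y
    N⟨x⟩∩R⊆Y (x~v , v∈R) with inR v∈R
    ... | inS v∈S = ⊥-elim (x≁S v∈S x~v)
    ... | inY v∈Y = v∈Y
    ... | isX v≡x = ⊥-elim (Adj⇒≢ G x~v (sym v≡x))

lemma27 : ∀ {n : ℕ} (G : Graph n) → C3C5C6Free G → (x : Fin n) (Y : Subset n) →
    (∀ y → y ∈ Y → Adj G x y) → 2 ≤ ∣ Y ∣ → (R : Subset n) →
    (MinRed G R × RedIsSingleton G R x × NbhdMeet≡ G x R Y)
    ⇔ (∃ λ S → R ≡ (S ∪ Y) ∪ ⁅ x ⁆
         × (∀ s → s ∈ S → InN2 G x s)
         × (∀ s → s ∈ S → ¬ InNbhdSet G Y s)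
         × (∀ y → y ∈ Y → PrivNonempty G y (Y ∪ ⁅ x ⁆))
         × MinDominatesNxMinusY G x Y S)
lemma27 G (noC3 , noC5 , _) x Y Y⊆N⟨x⟩ 2≤∣Y∣ R = mk⇔
  (λ (minRed , red≡x , N⟨x⟩∩R≡Y) →
    let open MinRed⇒Decomposition G noC3 x Y Y⊆N⟨x⟩ 2≤∣Y∣ R minRed red≡x N⟨x⟩∩R≡Y
    in S , R≡S∪Y∪x , S⊆N² , S∩N⟨Y⟩≡∅ , Y-private , S-dominates , S-minimal)
  (λ (S , R≡S∪Y∪x , S⊆N² , S∩N⟨Y⟩≡∅ , Y-private , S-minDom) →
    let open Decomposition⇒MinRed G noC3 noC5 x Y Y⊆N⟨x⟩ Y≢∅
                                  R S R≡S∪Y∪x S⊆N² S∩N⟨Y⟩≡∅ Y-private S-minDom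
    in R-minRed , R-red≡x , N⟨x⟩∩R≡Y)
  where
  Y≢∅ : Nonempty Y
  Y≢∅ = map₂ proj₁ (2≤∣p∣⇒∃∈p≢ Y 2≤∣Y∣ x)
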